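{- Let $f$ be a real-valued function on pairs of non-negative integers which is symmetric ($f(x,y)=f(y,x)$) and monotone (if $x\le x'$ and $y\le y'$ then $f(x,y)\le f(x',y')$), and let $Q(G)=\sum_{uv\in E(G)}f(d(u),d(v))$. Then for every $n$ there is an integer $0\le m\le n$ such that the maximum of $Q(G)$ over all $n$-vertex triangle-free graphs $G$ equals $Q(K_{m,n-m})$.
   Context: Graphs are finite and simple; $d(v)$ denotes the degree of $v$ in $G$. $K_{m,n-m}$ is the complete bipartite graph with parts of sizes $m$ and $n-m$. -}

module Defs where

open import Level using (0ℓ)
open import Data.Bool using (Bool; true; false; if_then_else_; _xor_; _∧_)
open import Data.Empty using (⊥)
open import Data.Nat using (ℕ; _<ᵇ_)
import Data.Nat as ℕ
open import Data.Fin using (Fin; toℕ)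
open import Data.List using (List; foldr; map; allFin)
open import Relation.Binary.PropositionalEquality using (_≡_)
open import Relation.Binary.Structures using (IsTotalOrder)
open import Algebra.Structures using (IsAbelianGroup)

record OrderedAbelianGroup : Set₁ where
  infixl 6 _+_
  infix 4 _≤_
  field
    Carrier        : Set
    _+_            : Carrier → Carrier → Carrier
    0#             : Carrier
    -_             : Carrier → Carrier
    _≤_            : Carrier → Carrier → Set
    isAbelianGroup : IsAbelianGroup _≡_ _+_ 0# -_
    isTotalOrder   : IsTotalOrder _≡_ _≤_
    +-monoʳ-≤      : ∀ z {x y} → x ≤ y → z + x ≤ z + y

record Graph (n : ℕ) : Set where
  field
    adj    : Fin n → Fin n → Bool
    sym    : ∀ i j → adj i j ≡ adj j i
    irrefl : ∀ i → adj i i ≡ false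
open Graph public

deg : ∀ {n} → Graph n → Fin n → ℕ
deg {n} G v = foldr ℕ._+_ 0 (map (λ w → if adj G v w then 1 else 0) (allFin n))

TriangleFree : ∀ {n} → Graph n → Set
TriangleFree G = ∀ i j k → adj G i j ≡ true → adj G j k ≡ true → adj G i k ≡ true → ⊥

-- complete bipartite graph K_{m,n-m}: parts {v | v < m} and {v | m ≤ v}
completeBipartite : (n m : ℕ) → Graph n
completeBipartite n m = record { adj = a ; sym = s ; irrefl = r }
  where
  open import Data.Bool.Properties using (xor-comm; xor-same)
  a : Fin n → Fin n → Bool
  a i j = (toℕ i <ᵇ m) xor (toℕ j <ᵇ m)
  s : ∀ i j → a i j ≡ a j i
  s i j = xor-comm (toℕ i <ᵇ m) (toℕ j <ᵇ m)
  r : ∀ i → a i i ≡ false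
  r i = xor-same (toℕ i <ᵇ m)

module _ (R : OrderedAbelianGroup) where
  open OrderedAbelianGroup R

  Symmetric : (ℕ → ℕ → Carrier) → Set
  Symmetric f = ∀ x y → f x y ≡ f y x

  Monotone : (ℕ → ℕ → Carrier) → Set
  Monotone f = ∀ {x x′ y y′} → x ℕ.≤ x′ → y ℕ.≤ y′ → f x y ≤ f x′ y′

  Σ[_] : List Carrier → Carrier
  Σ[ xs ] = foldr _+_ 0# xs

  -- Q(G) = Σ_{uv ∈ E(G)} f(d(u), d(v)); each edge {i,j} counted once via i < j
  Q : (ℕ → ℕ → Carrier) → ∀ {n} → Graph n → Carrier
  Q f {n} G = Σ[ map (λ i → Σ[ map (λ j →
      if (toℕ i <ᵇ toℕ j) ∧ adj G i j then f (deg G i) (deg G j) else 0#)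
      (allFin n) ]) (allFin n) ]

-- In a triangle-free graph the neighbourhood of a vertex x is independent, so every edge has an
-- endpoint among the n − d(x) non-neighbours of x, and adjacent u, v satisfy d(u) + d(v) ≤ n.
-- With f⁺ = max(f, 0), which makes counting an edge twice harmless,
--   Q(G) ≤ Σ_{u ≁ x} Σ_{v ~ u} f⁺(d(u), d(v)) ≤ Σ_{u ≁ x} d(u) f⁺(d(u), n − d(u)).
-- Choosing x to maximise d(x) f⁺(d(x), n − d(x)) bounds this by d(x) (n − d(x)) f⁺(d(x), n − d(x)),
-- which is Q(K_{d(x), n−d(x)}) or, where f is negative, 0 = Q(K_{0,n}).

module Submission where

open import Defs
open import Data.Nat using (ℕ; _≤_)
open import Data.Product using (Σ; _×_)

open import Level using (0ℓ)
open import Algebra.Bundles using (CommutativeMonoid)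
open import Algebra.Structures using (IsAbelianGroup)
import Algebra.Construct.NaturalChoice.Max as Max
import Algebra.Properties.CommutativeMonoid.Sum as Sum
import Algebra.Properties.Monoid.Mult as Mult
open import Data.Bool using (Bool; true; false; if_then_else_; not; _∧_; _∨_; _xor_)
open import Data.Empty using (⊥; ⊥-elim)
open import Data.Fin using (Fin; zero; suc; toℕ; fromℕ<)
open import Data.Fin.Properties using (toℕ≤pred[n]; toℕ-fromℕ<)
import Data.List as List
open import Data.List using (allFin)
open import Data.List.Properties using (map-tabulate)
open import Data.List.Membership.Propositional.Properties using (∈-allFin)
import Data.List.Extrema as Extrema
open import Data.List.Relation.Unary.All using (lookup)
open import Data.Nat using (zero; suc; _+_; _*_; _∸_; _<ᵇ_; z≤n; s≤s)
open import Data.Nat.Properties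
  using ( +-suc; *-comm; m≤m+n; m≤n⇒m≤1+n; m+n∸m≡n; m+n≤o⇒m≤o∸n
        ; <-asym; <-trans; <-≤-trans; ≮⇒≥; ≤-refl; <ᵇ-reflects-<)
open import Data.Product using (_,_; ∃-syntax)
open import Data.Sum using (_⊎_; inj₁; inj₂)
import Data.Vec.Functional as Vector
open import Function using (_∘_)
open import Relation.Binary.Bundles using (TotalOrder)
open import Relation.Binary.Structures using (IsTotalOrder)
open import Relation.Binary.PropositionalEquality
  using (_≡_; refl; trans; cong; cong₂; subst; subst₂; module ≡-Reasoning)
  renaming (sym to ≡-sym)
open import Relation.Nullary.Reflects using (ofʸ; ofⁿ)
import Relation.Binary.Reasoning.PartialOrder

foldr-tabulate : ∀ {A B : Set} (_∙_ : A → B → B) (e : B) {n} (g : Fin n → A) →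
                 List.foldr _∙_ e (List.tabulate g) ≡ Vector.foldr _∙_ e g
foldr-tabulate _∙_ e {zero}  g = refl
foldr-tabulate _∙_ e {suc n} g = cong (g zero ∙_) (foldr-tabulate _∙_ e (g ∘ suc))

foldr-map-allFin : ∀ {A B : Set} (_∙_ : A → B → B) (e : B) {n} (g : Fin n → A) →
                   List.foldr _∙_ e (List.map g (allFin n)) ≡ Vector.foldr _∙_ e g
foldr-map-allFin _∙_ e g =
  trans (cong (List.foldr _∙_ e) (map-tabulate (λ i → i) g)) (foldr-tabulate _∙_ e g)

count : ∀ {n} → (Fin n → Bool) → ℕ
count p = Vector.foldr _+_ 0 (λ i → if p i then 1 else 0)

count-complement : ∀ {n} (p : Fin n → Bool) → count p + count (not ∘ p) ≡ n
count-complement {zero}  p = refl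
count-complement {suc n} p with p zero
... | true  = cong suc (count-complement (p ∘ suc))
... | false = trans (+-suc (count (p ∘ suc)) _) (cong suc (count-complement (p ∘ suc)))

count-not : ∀ {n} (p : Fin n → Bool) → count (not ∘ p) ≡ n ∸ count p
count-not p = trans (≡-sym (m+n∸m≡n (count p) _)) (cong (_∸ count p) (count-complement p))

count-disjoint : ∀ {n} (p q : Fin n → Bool) → (∀ i → p i ≡ true → q i ≡ true → ⊥) →
                 count p + count q ≤ n
count-disjoint {zero}  p q disjoint = z≤n
count-disjoint {suc n} p q disjoint
  with p zero in p₀ | q zero in q₀ | count-disjoint (p ∘ suc) (q ∘ suc) (disjoint ∘ suc)
... | true  | true  | _    = ⊥-elim (disjoint zero p₀ q₀)
... | true  | false | rest = s≤s rest
... | false | true  | rest = subst (_≤ suc n) (≡-sym (+-suc (count (p ∘ suc)) _)) (s≤s rest)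
... | false | false | rest = m≤n⇒m≤1+n rest

count-<ᵇ : ∀ {n m} → m ≤ n → count {n} (λ i → toℕ i <ᵇ m) ≡ m
count-<ᵇ {zero}  z≤n       = refl
count-<ᵇ {suc n} z≤n       = count-<ᵇ {n} z≤n
count-<ᵇ {suc n} (s≤s m≤n) = cong suc (count-<ᵇ m≤n)

count-≮ᵇ : ∀ {n m} → m ≤ n → count {n} (λ i → not (toℕ i <ᵇ m)) ≡ n ∸ m
count-≮ᵇ {n} {m} m≤n =
  trans (count-not {n} (λ i → toℕ i <ᵇ m)) (cong (n ∸_) (count-<ᵇ m≤n))

module _ {n : ℕ} (G : Graph n) where

  deg≡count : ∀ v → deg G v ≡ count (adj G v)
  deg≡count v = foldr-map-allFin _+_ 0 (λ w → if adj G v w then 1 else 0)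

  deg≤n : ∀ v → deg G v ≤ n
  deg≤n v = subst₂ _≤_ (≡-sym (deg≡count v)) (count-complement (adj G v)) (m≤m+n _ _)

  count-non-neighbours : ∀ x → count (not ∘ adj G x) ≡ n ∸ deg G x
  count-non-neighbours x = trans (count-not (adj G x)) (cong (n ∸_) (≡-sym (deg≡count x)))

  module _ (triangleFree : TriangleFree G) where

    deg≤n∸deg : ∀ {i j} → adj G i j ≡ true → deg G j ≤ n ∸ deg G i
    deg≤n∸deg {i} {j} i~j rewrite deg≡count i | deg≡count j =
      m+n≤o⇒m≤o∸n _ (count-disjoint (adj G j) (adj G i) no-common-neighbour)
      where
      no-common-neighbour : ∀ w → adj G j w ≡ true → adj G i w ≡ true → ⊥
      no-common-neighbour w = triangleFree i j w i~j

    non-neighbours-cover-edges : ∀ x {i j} → adj G i j ≡ true →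
                                 not (adj G x i) ∨ not (adj G x j) ≡ true
    non-neighbours-cover-edges x {i} {j} i~j with adj G x i in x~i | adj G x j in x~j
    ... | true  | true  = ⊥-elim (triangleFree x i j x~i i~j x~j)
    ... | true  | false = refl
    ... | false | _     = refl

deg-completeBipartite : ∀ {n m} → m ≤ n → ∀ i →
                        deg (completeBipartite n m) i ≡ (if toℕ i <ᵇ m then n ∸ m else m)
deg-completeBipartite {n} {m} m≤n i =
  trans (deg≡count (completeBipartite n m) i) (by-side (toℕ i <ᵇ m))
  where
  by-side : ∀ b → count {n} (λ j → b xor (toℕ j <ᵇ m)) ≡ (if b then n ∸ m else m)
  by-side true  = count-≮ᵇ m≤n
  by-side false = count-<ᵇ m≤n

module _ {a ℓ₁ ℓ₂} (O : TotalOrder a ℓ₁ ℓ₂) where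
  open TotalOrder O using (Carrier) renaming (_≤_ to _≤ₒ_)
  open Extrema O using (argmax; f[xs]≤f[argmax])

  ∃-argmax : ∀ {n} (g : Fin (suc n) → Carrier) → ∃[ x ] (∀ i → g i ≤ₒ g x)
  ∃-argmax {n} g = argmax g zero (allFin (suc n)) ,
    λ i → lookup (f[xs]≤f[argmax] zero (allFin (suc n))) (∈-allFin i)

  ∃-argmax-≤ : ∀ n (g : ℕ → Carrier) → ∃[ m ] m ≤ n × (∀ {k} → k ≤ n → g k ≤ₒ g m)
  ∃-argmax-≤ n g with ∃-argmax (g ∘ toℕ {suc n})
  ... | x , x-max = toℕ x , toℕ≤pred[n] x , λ {k} k≤n →
    subst (λ k → g k ≤ₒ g (toℕ x)) (toℕ-fromℕ< (s≤s k≤n)) (x-max (fromℕ< (s≤s k≤n)))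

module OrderedAbelianGroupProperties (R : OrderedAbelianGroup) where
  open OrderedAbelianGroup R public renaming (_+_ to _⊕_; _≤_ to _≼_)
  open IsAbelianGroup isAbelianGroup using (isCommutativeMonoid; comm; identityˡ; identityʳ)
  open IsTotalOrder isTotalOrder public
    using () renaming (refl to ≼-refl; reflexive to ≼-reflexive; trans to ≼-trans)

  commutativeMonoid : CommutativeMonoid 0ℓ 0ℓ
  commutativeMonoid = record { isCommutativeMonoid = isCommutativeMonoid }

  totalOrder : TotalOrder 0ℓ 0ℓ 0ℓ
  totalOrder = record { isTotalOrder = isTotalOrder }

  open Sum commutativeMonoid public
    using (sum; sum-cong-≗; ∑-distrib-+; ∑-comm; sum-replicate; sum-replicate-zero)
  open Mult (CommutativeMonoid.monoid commutativeMonoid) public using (×-assocˡ) renaming (_×_ to _·_)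
  open Max totalOrder using (_⊔_; ⊔-sel; x≤x⊔y; x≤y⊔x; ⊔-mono-≤)
  module ≼-Reasoning = Relation.Binary.Reasoning.PartialOrder (TotalOrder.poset totalOrder)

  ·-zeroʳ : ∀ k → k · 0# ≡ 0#
  ·-zeroʳ k = trans (≡-sym (sum-replicate k)) (sum-replicate-zero k)

  ⊕-monoˡ-≼ : ∀ z {x y} → x ≼ y → x ⊕ z ≼ y ⊕ z
  ⊕-monoˡ-≼ z {x} {y} x≼y = subst₂ _≼_ (comm z x) (comm z y) (+-monoʳ-≤ z x≼y)

  ⊕-mono-≼ : ∀ {x y u v} → x ≼ y → u ≼ v → x ⊕ u ≼ y ⊕ v
  ⊕-mono-≼ {y = y} x≼y u≼v = ≼-trans (⊕-monoˡ-≼ _ x≼y) (+-monoʳ-≤ y u≼v)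

  x≼x⊕y : ∀ x {y} → 0# ≼ y → x ≼ x ⊕ y
  x≼x⊕y x 0≼y = subst (_≼ x ⊕ _) (identityʳ x) (+-monoʳ-≤ x 0≼y)

  ∑-mono-≼ : ∀ {n} {g h : Fin n → Carrier} → (∀ i → g i ≼ h i) → sum g ≼ sum h
  ∑-mono-≼ {zero}  g≼h = ≼-refl
  ∑-mono-≼ {suc n} g≼h = ⊕-mono-≼ (g≼h zero) (∑-mono-≼ (g≼h ∘ suc))

  ∑∑-distrib-⊕ : ∀ {n} (g h : Fin n → Fin n → Carrier) →
                 sum (λ i → sum (λ j → g i j ⊕ h i j))
                   ≡ sum (λ i → sum (g i)) ⊕ sum (λ i → sum (h i))
  ∑∑-distrib-⊕ g h =
    trans (sum-cong-≗ (λ i → ∑-distrib-+ (g i) (h i)))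
          (∑-distrib-+ (λ i → sum (g i)) (λ i → sum (h i)))

  0≼if : ∀ b {x} → 0# ≼ x → 0# ≼ (if b then x else 0#)
  0≼if true  0≼x = 0≼x
  0≼if false _   = ≼-refl

  if-mono-≼ : ∀ b {x y} → x ≼ y → (if b then x else 0#) ≼ (if b then y else 0#)
  if-mono-≼ true  x≼y = x≼y
  if-mono-≼ false _   = ≼-refl

  if-∧false : ∀ b {x} → (if b ∧ false then x else 0#) ≡ 0#
  if-∧false true  = refl
  if-∧false false = refl

  if-≼ : ∀ b {x y} → (b ≡ true → x ≼ y) → 0# ≼ y → (if b then x else 0#) ≼ y
  if-≼ true  x≼y _   = x≼y refl
  if-≼ false _   0≼y = 0≼y

  if-distrib-⊕ : ∀ b x y →
                 (if b then x ⊕ y else 0#) ≡ (if b then x else 0#) ⊕ (if b then y else 0#)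
  if-distrib-⊕ true  x y = refl
  if-distrib-⊕ false x y = ≡-sym (identityˡ 0#)

  ∑-if : ∀ {n} b (g : Fin n → Carrier) →
         sum (λ j → if b then g j else 0#) ≡ (if b then sum g else 0#)
  ∑-if {n} true  g = refl
  ∑-if {n} false g = sum-replicate-zero n

  ∑-if-const : ∀ {n} (p : Fin n → Bool) c → sum (λ i → if p i then c else 0#) ≡ count p · c
  ∑-if-const {zero}  p c = refl
  ∑-if-const {suc n} p c with p zero
  ... | true  = cong (c ⊕_) (∑-if-const (p ∘ suc) c)
  ... | false = trans (identityˡ _) (∑-if-const (p ∘ suc) c)

  ≼-if⊕if : ∀ a b {x} → a ∨ b ≡ true → 0# ≼ x →
            x ≼ (if a then x else 0#) ⊕ (if b then x else 0#)
  ≼-if⊕if true  b     {x} _ 0≼x = x≼x⊕y x (0≼if b 0≼x)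
  ≼-if⊕if false true  {x} _ _   = ≼-reflexive (≡-sym (identityˡ x))

  if<ᵇ⊕if>ᵇ-≼ : ∀ m n {x} → 0# ≼ x →
                (if m <ᵇ n then x else 0#) ⊕ (if n <ᵇ m then x else 0#) ≼ x
  if<ᵇ⊕if>ᵇ-≼ m n {x} 0≼x with m <ᵇ n | <ᵇ-reflects-< m n | n <ᵇ m | <ᵇ-reflects-< n m
  ... | true  | ofʸ m<n | true  | ofʸ n<m = ⊥-elim (<-asym m<n n<m)
  ... | true  | _       | false | _       = ≼-reflexive (identityʳ x)
  ... | false | _       | true  | _       = ≼-reflexive (identityˡ x)
  ... | false | _       | false | _       = subst (_≼ x) (≡-sym (identityˡ 0#)) 0≼x

  ∑∑-pairs-≼ : ∀ {n} (g : Fin n → Fin n → Carrier) → (∀ i j → 0# ≼ g i j) →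
               sum (λ i → sum (λ j → if toℕ i <ᵇ toℕ j then g i j ⊕ g j i else 0#))
                 ≼ sum (λ i → sum (g i))
  ∑∑-pairs-≼ g 0≼g = begin
    sum (λ i → sum (λ j → if toℕ i <ᵇ toℕ j then g i j ⊕ g j i else 0#))
      ≡⟨ sum-cong-≗ (λ i → sum-cong-≗ (λ j → if-distrib-⊕ (toℕ i <ᵇ toℕ j) (g i j) (g j i))) ⟩
    sum (λ i → sum (λ j → below i j ⊕ above j i))
      ≡⟨ ∑∑-distrib-⊕ below (λ i j → above j i) ⟩
    sum (λ i → sum (below i)) ⊕ sum (λ i → sum (λ j → above j i))
      ≡⟨ cong (sum (λ i → sum (below i)) ⊕_) (∑-comm (λ i j → above j i)) ⟩
    sum (λ i → sum (below i)) ⊕ sum (λ i → sum (above i))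
      ≡⟨ ∑∑-distrib-⊕ below above ⟨
    sum (λ i → sum (λ j → below i j ⊕ above i j))
      ≤⟨ ∑-mono-≼ (λ i → ∑-mono-≼ (λ j → if<ᵇ⊕if>ᵇ-≼ (toℕ i) (toℕ j) (0≼g i j))) ⟩
    sum (λ i → sum (g i)) ∎
    where
    open ≼-Reasoning
    below above : _ → _ → Carrier
    below i j = if toℕ i <ᵇ toℕ j then g i j else 0#
    above i j = if toℕ j <ᵇ toℕ i then g i j else 0#

  _⁺ : Carrier → Carrier
  x ⁺ = x ⊔ 0#

  x≼x⁺ : ∀ x → x ≼ x ⁺
  x≼x⁺ x = x≤x⊔y x 0#

  0≼x⁺ : ∀ x → 0# ≼ x ⁺
  0≼x⁺ x = x≤y⊔x x 0#

  ⁺-mono-≼ : ∀ {x y} → x ≼ y → x ⁺ ≼ y ⁺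
  ⁺-mono-≼ x≼y = ⊔-mono-≤ x≼y ≼-refl

  ⁺-sel : ∀ x → x ⁺ ≡ x ⊎ x ⁺ ≡ 0#
  ⁺-sel x = ⊔-sel x 0#

module _ (R : OrderedAbelianGroup) where
  open OrderedAbelianGroupProperties R

  Q≡∑∑ : ∀ f {n} (G : Graph n) →
         Q R f G ≡ sum (λ i → sum (λ j →
           if (toℕ i <ᵇ toℕ j) ∧ adj G i j then f (deg G i) (deg G j) else 0#))
  Q≡∑∑ f {n} G =
    trans (foldr-map-allFin _⊕_ 0# {n} _) (sum-cong-≗ (λ i → foldr-map-allFin _⊕_ 0# (summand i)))
    where
    summand : Fin n → Fin n → Carrier
    summand i j = if (toℕ i <ᵇ toℕ j) ∧ adj G i j then f (deg G i) (deg G j) else 0#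

  module _ (f : ℕ → ℕ → Carrier) {n m : ℕ} (m≤n : m ≤ n) where
    private
      K : Graph n
      K = completeBipartite n m

      left : Fin n → Bool
      left i = toℕ i <ᵇ m

      c : Carrier
      c = f (n ∸ m) m

    summand-completeBipartite : ∀ i j →
      (if (toℕ i <ᵇ toℕ j) ∧ adj K i j then f (deg K i) (deg K j) else 0#)
        ≡ (if left i then (if not (left j) then c else 0#) else 0#)
    summand-completeBipartite i j
      rewrite deg-completeBipartite m≤n i | deg-completeBipartite m≤n j
      with left i | <ᵇ-reflects-< (toℕ i) m | left j | <ᵇ-reflects-< (toℕ j) m
         | toℕ i <ᵇ toℕ j | <ᵇ-reflects-< (toℕ i) (toℕ j)
    ... | true  | _       | true  | _       | i<ᵇj  | _       = if-∧false i<ᵇj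
    ... | false | _       | false | _       | i<ᵇj  | _       = if-∧false i<ᵇj
    ... | true  | _       | false | _       | true  | _       = refl
    ... | true  | ofʸ i<m | false | ofⁿ j≮m | false | ofⁿ i≮j =
      ⊥-elim (i≮j (<-≤-trans i<m (≮⇒≥ j≮m)))
    ... | false | _       | true  | _       | false | _       = refl
    ... | false | ofⁿ i≮m | true  | ofʸ j<m | true  | ofʸ i<j =
      ⊥-elim (i≮m (<-trans i<j j<m))

    Q-completeBipartite : Q R f K ≡ (m * (n ∸ m)) · f (n ∸ m) m
    Q-completeBipartite = begin
      Q R f K
        ≡⟨ Q≡∑∑ f K ⟩
      sum (λ i → sum (λ j → if (toℕ i <ᵇ toℕ j) ∧ adj K i j then f (deg K i) (deg K j) else 0#))
        ≡⟨ sum-cong-≗ (λ i → sum-cong-≗ (summand-completeBipartite i)) ⟩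
      sum (λ i → sum (λ j → if left i then (if not (left j) then c else 0#) else 0#))
        ≡⟨ sum-cong-≗ (λ i → ∑-if {n} (left i) _) ⟩
      sum (λ i → if left i then sum (λ j → if not (left j) then c else 0#) else 0#)
        ≡⟨ sum-cong-≗ (λ i → cong (λ s → if left i then s else 0#) (∑-if-const (not ∘ left) c)) ⟩
      sum (λ i → if left i then count (not ∘ left) · c else 0#)
        ≡⟨ ∑-if-const left _ ⟩
      count left · count (not ∘ left) · c
        ≡⟨ cong₂ (λ p q → p · q · c) (count-<ᵇ m≤n) (count-≮ᵇ m≤n) ⟩
      m · (n ∸ m) · c
        ≡⟨ ×-assocˡ c m (n ∸ m) ⟩
      (m * (n ∸ m)) · c ∎
      where open ≡-Reasoning

  module _ (f : ℕ → ℕ → Carrier) (f-sym : Symmetric R f) (f-mono : Monotone R f) where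

    F : ℕ → ℕ → Carrier
    F a b = f a b ⁺

    bipartiteBound : ℕ → ℕ → Carrier
    bipartiteBound n k = (k * (n ∸ k)) · F k (n ∸ k)

    bipartiteBound-≼ : ∀ {n M} → (∀ {k} → k ≤ n → Q R f (completeBipartite n k) ≼ M) →
                       ∀ {k} → k ≤ n → bipartiteBound n k ≼ M
    bipartiteBound-≼ {n} {M} Q-K≼M {k} k≤n with ⁺-sel (f k (n ∸ k))
    ... | inj₁ F≡f = subst (_≼ M) Q-K≡bound (Q-K≼M k≤n)
      where
      Q-K≡bound : Q R f (completeBipartite n k) ≡ bipartiteBound n k
      Q-K≡bound = trans (Q-completeBipartite f {n} k≤n)
                (cong ((k * (n ∸ k)) ·_) (trans (f-sym (n ∸ k) k) (≡-sym F≡f)))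
    ... | inj₂ F≡0 = subst (_≼ M) Q-K₀≡bound (Q-K≼M z≤n)
      where
      Q-K₀≡bound : Q R f (completeBipartite n 0) ≡ bipartiteBound n k
      Q-K₀≡bound = trans (Q-completeBipartite f {n} z≤n)
                 (≡-sym (trans (cong ((k * (n ∸ k)) ·_) F≡0) (·-zeroʳ (k * (n ∸ k)))))

    star : ∀ {n} → Graph n → Fin n → Carrier
    star G i = sum (λ j → if adj G i j then F (deg G i) (deg G j) else 0#)

    starBound : ∀ {n} → Graph n → Fin n → Carrier
    starBound {n} G i = deg G i · F (deg G i) (n ∸ deg G i)

    star≼starBound : ∀ {n} (G : Graph n) → TriangleFree G → ∀ i → star G i ≼ starBound G i
    star≼starBound {n} G triangleFree i = begin
      sum (λ j → if adj G i j then F (deg G i) (deg G j) else 0#)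
        ≤⟨ ∑-mono-≼ summand-≼ ⟩
      sum (λ j → if adj G i j then F (deg G i) (n ∸ deg G i) else 0#)
        ≡⟨ ∑-if-const (adj G i) _ ⟩
      count (adj G i) · F (deg G i) (n ∸ deg G i)
        ≡⟨ cong (_· F (deg G i) (n ∸ deg G i)) (deg≡count G i) ⟨
      starBound G i ∎
      where
      open ≼-Reasoning
      summand-≼ : ∀ j → (if adj G i j then F (deg G i) (deg G j) else 0#)
                          ≼ (if adj G i j then F (deg G i) (n ∸ deg G i) else 0#)
      summand-≼ j with adj G i j in i~j
      ... | true  = ⁺-mono-≼ (f-mono ≤-refl (deg≤n∸deg G triangleFree i~j))
      ... | false = ≼-refl

    Q≼non-neighbour-stars : ∀ {n} (G : Graph n) → TriangleFree G → ∀ x →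
                            Q R f G ≼ sum (λ i → if not (adj G x i) then star G i else 0#)
    Q≼non-neighbour-stars {n} G triangleFree x = begin
      Q R f G
        ≡⟨ Q≡∑∑ f G ⟩
      sum (λ i → sum (λ j → if (toℕ i <ᵇ toℕ j) ∧ adj G i j then f (d i) (d j) else 0#))
        ≤⟨ ∑-mono-≼ (λ i → ∑-mono-≼ (summand-≼ i)) ⟩
      sum (λ i → sum (λ j → if toℕ i <ᵇ toℕ j then h i j ⊕ h j i else 0#))
        ≤⟨ ∑∑-pairs-≼ h 0≼h ⟩
      sum (λ i → sum (h i))
        ≡⟨ sum-cong-≗ (λ i → ∑-if {n} (B i) _) ⟩
      sum (λ i → if B i then star G i else 0#) ∎
      where
      open ≼-Reasoning
      d : Fin n → ℕ
      d = deg G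
      B : Fin n → Bool
      B i = not (adj G x i)
      h : Fin n → Fin n → Carrier
      h i j = if B i then (if adj G i j then F (d i) (d j) else 0#) else 0#

      0≼h : ∀ i j → 0# ≼ h i j
      0≼h i j = 0≼if (B i) (0≼if (adj G i j) (0≼x⁺ _))

      h-edge : ∀ {i j} → adj G i j ≡ true → h i j ≡ (if B i then F (d i) (d j) else 0#)
      h-edge {i} {j} i~j = cong (λ a → if B i then (if a then F (d i) (d j) else 0#) else 0#) i~j

      edge-≼ : ∀ {i j} → adj G i j ≡ true → F (d i) (d j) ≼ h i j ⊕ h j i
      edge-≼ {i} {j} i~j = begin
        F (d i) (d j)
          ≤⟨ ≼-if⊕if (B i) (B j) (non-neighbours-cover-edges G triangleFree x i~j) (0≼x⁺ _) ⟩
        (if B i then F (d i) (d j) else 0#) ⊕ (if B j then F (d i) (d j) else 0#)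
          ≡⟨ cong₂ _⊕_ (h-edge i~j) (trans (h-edge j~i) F-sym) ⟨
        h i j ⊕ h j i ∎
        where
        j~i = trans (Graph.sym G j i) i~j
        F-sym = cong (λ y → if B j then y ⁺ else 0#) (f-sym (d j) (d i))

      summand-≼ : ∀ i j → (if (toℕ i <ᵇ toℕ j) ∧ adj G i j then f (d i) (d j) else 0#)
                            ≼ (if toℕ i <ᵇ toℕ j then h i j ⊕ h j i else 0#)
      summand-≼ i j with toℕ i <ᵇ toℕ j
      ... | false = ≼-refl
      ... | true  = if-≼ (adj G i j) (λ i~j → ≼-trans (x≼x⁺ _) (edge-≼ i~j))
                      (≼-trans (0≼h i j) (x≼x⊕y (h i j) (0≼h j i)))

    Q≼bipartiteBound-deg : ∀ {n} (G : Graph n) → TriangleFree G →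
                           ∀ x → (∀ i → starBound G i ≼ starBound G x) →
                           Q R f G ≼ bipartiteBound n (deg G x)
    Q≼bipartiteBound-deg {n} G triangleFree x x-max = begin
      Q R f G
        ≤⟨ Q≼non-neighbour-stars G triangleFree x ⟩
      sum (λ i → if not (adj G x i) then star G i else 0#)
        ≤⟨ ∑-mono-≼ (λ i → if-mono-≼ (not (adj G x i)) (star≼starBound[x] i)) ⟩
      sum (λ i → if not (adj G x i) then starBound G x else 0#)
        ≡⟨ ∑-if-const (not ∘ adj G x) _ ⟩
      count (not ∘ adj G x) · deg G x · F (deg G x) (n ∸ deg G x)
        ≡⟨ cong (λ k → k · deg G x · F (deg G x) (n ∸ deg G x)) (count-non-neighbours G x) ⟩
      (n ∸ deg G x) · deg G x · F (deg G x) (n ∸ deg G x)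
        ≡⟨ ×-assocˡ _ (n ∸ deg G x) (deg G x) ⟩
      ((n ∸ deg G x) * deg G x) · F (deg G x) (n ∸ deg G x)
        ≡⟨ cong (_· F (deg G x) (n ∸ deg G x)) (*-comm (n ∸ deg G x) (deg G x)) ⟩
      bipartiteBound n (deg G x) ∎
      where
      open ≼-Reasoning
      star≼starBound[x] : ∀ i → star G i ≼ starBound G x
      star≼starBound[x] i = ≼-trans (star≼starBound G triangleFree i) (x-max i)

    Q≼bipartiteBound : ∀ {n} (G : Graph n) → TriangleFree G →
                       ∃[ k ] k ≤ n × Q R f G ≼ bipartiteBound n k
    Q≼bipartiteBound {zero}  _ _            = 0 , z≤n , ≼-refl
    Q≼bipartiteBound {suc n} G triangleFree =
      let x , x-max = ∃-argmax totalOrder (starBound G)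
      in deg G x , deg≤n G x , Q≼bipartiteBound-deg G triangleFree x x-max

theorem1p5 : (R : OrderedAbelianGroup) → (f : ℕ → ℕ → OrderedAbelianGroup.Carrier R)
    → Symmetric R f → Monotone R f → (n : ℕ)
    → Σ ℕ (λ m → m ≤ n ×
        (∀ (G : Graph n) → TriangleFree G
          → OrderedAbelianGroup._≤_ R (Q R f G) (Q R f (completeBipartite n m))))
theorem1p5 R f f-sym f-mono n =
  let m , m≤n , m-max = ∃-argmax-≤ totalOrder n (λ k → Q R f (completeBipartite n k))
  in m , m≤n , λ G triangleFree →
    let k , k≤n , Q≼bound = Q≼bipartiteBound R f f-sym f-mono G triangleFree
    in ≼-trans Q≼bound (bipartiteBound-≼ R f f-sym f-mono m-max k≤n)
  where open OrderedAbelianGroupProperties R using (totalOrder; ≼-trans)
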